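{- Let $G=(V,E)$ be a graph, $F\subseteq E$ and $U\subseteq V$. If $G'$ is a graph obtained from $G$ by subdividing each edge of $F$ an arbitrary number of times and attaching a path of arbitrary length to each vertex in $U$, then $\mathrm{pw}(G')\le \mathrm{pw}(G)+2$.
   Context: $\mathrm{pw}(G)$ denotes the pathwidth of $G$. Attaching a path to a vertex $u$ means adding a new path $(u,p_1,\dots,p_q)$ whose vertices $p_1,\dots,p_q$ are new. -}

module Defs where

open import Data.Nat using (ℕ; zero; suc; _≤_; _<_; _+_)
open import Data.Fin as Fin using (Fin; zero; suc; toℕ; inject₁)
open import Data.Bool using (Bool; true; false)
open import Data.List using (List; length)
open import Data.List.Membership.Propositional using (_∈_)
open import Data.Product using (Σ; ∃; _×_)
open import Data.Sum using (_⊎_)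
open import Relation.Binary.PropositionalEquality using (_≡_)

record Graph : Set where
  field
    n     : ℕ
    Adj   : Fin n → Fin n → Bool
    sym   : ∀ u v → Adj u v ≡ Adj v u
    loopless : ∀ u → Adj u u ≡ false

record PathDecomposition (V : Set) (E : V → V → Set) (k : ℕ) : Set where
  field
    m       : ℕ
    bag     : Fin m → List V
    width   : ∀ i → length (bag i) ≤ suc k
    cover   : ∀ v → ∃ λ i → v ∈ bag i
    edge    : ∀ u v → E u v → ∃ λ i → (u ∈ bag i × v ∈ bag i)
    contig  : ∀ v (i j l : Fin m) → i Fin.≤ j → j Fin.≤ l →
              v ∈ bag i → v ∈ bag l → v ∈ bag j

PathwidthAtMost : (V : Set) → (E : V → V → Set) → ℕ → Set
PathwidthAtMost V E k = PathDecomposition V E k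

Edge : (G : Graph) → Fin (Graph.n G) → Fin (Graph.n G) → Set
Edge G u v = Graph.Adj G u v ≡ true

-- The graph G' obtained from G by subdividing every edge {u,v} ∈ F
-- (u < v) exactly s u v times and attaching a path with q u new vertices
-- to every vertex u ∈ U.
module Construction (G : Graph)
  (F : Fin (Graph.n G) → Fin (Graph.n G) → Bool)
  (s : Fin (Graph.n G) → Fin (Graph.n G) → ℕ)
  (U : Fin (Graph.n G) → Bool)
  (q : Fin (Graph.n G) → ℕ) where

  open Graph G

  data V' : Set where
    orig : Fin n → V'
    sub  : (u v : Fin n) → toℕ u < toℕ v → F u v ≡ true → Fin (s u v) → V'
    pth  : (u : Fin n) → U u ≡ true → Fin (q u) → V'

  snoc : ∀ m → (Fin m → V') → V' → Fin (suc m) → V'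
  snoc zero    f last zero    = last
  snoc (suc m) f last zero    = f zero
  snoc (suc m) f last (suc k) = snoc m (λ i → f (suc i)) last k

  subChain : (u v : Fin n) (lt : toℕ u < toℕ v) (f : F u v ≡ true) →
             Fin (suc (suc (s u v))) → V'
  subChain u v lt f zero    = orig u
  subChain u v lt f (suc k) = snoc (s u v) (sub u v lt f) (orig v) k

  pathChain : (u : Fin n) (h : U u ≡ true) → Fin (suc (q u)) → V'
  pathChain u h zero    = orig u
  pathChain u h (suc k) = pth u h k

  data D : V' → V' → Set where
    keep : ∀ u v → Adj u v ≡ true → F u v ≡ false → D (orig u) (orig v)
    subE : ∀ u v lt f (k : Fin (suc (s u v))) →
           D (subChain u v lt f (inject₁ k)) (subChain u v lt f (suc k))
    pthE : ∀ u h (k : Fin (q u)) →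
           D (pathChain u h (inject₁ k)) (pathChain u h (suc k))

  E' : V' → V' → Set
  E' x y = D x y ⊎ D y x

module Submission where

open import Defs
open import Data.Nat using (ℕ; _+_)
open import Data.Fin using (Fin)
open import Data.Bool using (Bool; true; false)
open import Relation.Binary.PropositionalEquality using (_≡_)

-- Let B₀, …, B_{m-1} be a path decomposition of G of width k.  A "gadget"
-- is either a subdivided edge uv ∈ F, with interior vertices x₀ … x_{s-1},
-- or a path x₀ … x_{q-1} attached at u ∈ U.  Each gadget gets a host bag:
-- a bag containing its original end(s), which exists by the edge and cover
-- axioms of the decomposition.  Every bag B_i is replaced by a run of
-- copies B_i ∪ {x_t, x_{t+1}}, one for each gadget g hosted at i and each
-- step t (copies for gadgets hosted elsewhere add nothing).  Ordering all
-- copies lexicographically by (i, g, t) gives a path decomposition of G':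
-- the width grows by at most 2, consecutive chain vertices meet at a step,
-- an original vertex occurs in the copies of the bags it occurred in, and
-- x_r occurs exactly at the steps t ∈ {r-1, r} of its gadget in its host.

open import Data.Nat using (zero; suc; pred; _*_; _≤_; _<_; _<?_; z≤n; s≤s; _⊔_)
import Data.Nat.Properties as ℕₚ
open import Data.Fin
  using (zero; suc; toℕ; inject₁; fromℕ<; combine; remQuot; quotient; remainder)
  renaming (_≤_ to _≤ᶠ_; _≟_ to _≟ᶠ_)
import Data.Fin.Properties as Finₚ
import Data.Bool.Properties as Boolₚ
open import Data.List using (List; []; _∷_; _++_; map; length; allFin)
open import Data.List.Properties using (length-++; length-map)
open import Data.List.Membership.Propositional using (_∈_)
open import Data.List.Membership.Propositional.Properties
  using (∈-++⁺ˡ; ∈-++⁺ʳ; ∈-++⁻; ∈-map⁺; ∈-map⁻; ∈-allFin)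
open import Data.List.Relation.Unary.Any using (here)
import Data.List.Relation.Unary.All as All
open import Data.List.Extrema ℕₚ.≤-totalOrder using (max; xs≤max)
open import Data.Product using (Σ; ∃; _×_; _,_; proj₁; proj₂; map₂)
open import Data.Sum using (_⊎_; inj₁; inj₂)
open import Data.Empty using (⊥-elim)
open import Relation.Nullary using (yes; no; ¬_)
open import Relation.Binary.PropositionalEquality
  using (refl; sym; trans; cong; cong₂; subst; subst₂; ≡-≟-identity; module ≡-Reasoning)
open import Axiom.UniquenessOfIdentityProofs using (module Decidable⇒UIP)
open import Function.Bundles using (_⇔_; mk⇔; module Equivalence)

Convex : ∀ {m} → (Fin m → Set) → Set
Convex {m} P = ∀ (i j l : Fin m) → i ≤ᶠ j → j ≤ᶠ l → P i → P l → P j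

convex-⇔ : ∀ {m} {P Q : Fin m → Set} → (∀ i → P i ⇔ Q i) → Convex P → Convex Q
convex-⇔ P⇔Q convex-P i j l i≤j j≤l Qi Ql =
  to (P⇔Q j) (convex-P i j l i≤j j≤l (from (P⇔Q i) Qi) (from (P⇔Q l) Ql))
  where open Equivalence

-- Fin (a * b) is Fin a × Fin b in lexicographic order: combine is monotone,
-- so its first coordinate, and its second one on a fixed first coordinate,
-- are monotone in the position.
combine-reflects-≤ˡ : ∀ {a b} {i i' : Fin a} (j j' : Fin b) →
                      combine i j ≤ᶠ combine i' j' → i ≤ᶠ i'
combine-reflects-≤ˡ j j' le =
  ℕₚ.≮⇒≥ (λ i'<i → ℕₚ.<⇒≱ (Finₚ.combine-monoˡ-< j' j i'<i) le)

combine-reflects-≤ʳ : ∀ {a b} (i : Fin a) {j j' : Fin b} →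
                      combine i j ≤ᶠ combine i j' → j ≤ᶠ j'
combine-reflects-≤ʳ {b = b} i {j} {j'} le = ℕₚ.+-cancelˡ-≤ (b * toℕ i) (toℕ j) (toℕ j')
  (subst₂ _≤_ (Finₚ.toℕ-combine i j) (Finₚ.toℕ-combine i j') le)

quotient-mono : ∀ {a} b {y y' : Fin (a * b)} →
                y ≤ᶠ y' → quotient {a} b y ≤ᶠ quotient {a} b y'
quotient-mono {a} b {y} {y'} le =
  combine-reflects-≤ˡ (remainder {a} b y) (remainder {a} b y')
    (subst₂ _≤ᶠ_ (sym (Finₚ.combine-remQuot {a} b y)) (sym (Finₚ.combine-remQuot {a} b y')) le)

remainder-mono : ∀ {a} b {y y' : Fin (a * b)} → y ≤ᶠ y' →
                 quotient {a} b y ≡ quotient {a} b y' →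
                 remainder {a} b y ≤ᶠ remainder {a} b y'
remainder-mono {a} b {y} {y'} le same = combine-reflects-≤ʳ (quotient {a} b y)
  (subst₂ _≤ᶠ_ (sym (Finₚ.combine-remQuot {a} b y)) (sym y'-split) le)
  where
  y'-split : combine (quotient {a} b y) (remainder {a} b y') ≡ y'
  y'-split = trans (cong (λ c → combine c (remainder {a} b y')) same)
                   (Finₚ.combine-remQuot {a} b y')

convex-quotient : ∀ {a} b {P : Fin a → Set} → Convex P →
                  Convex (λ (y : Fin (a * b)) → P (quotient {a} b y))
convex-quotient b convex-P y₁ y₂ y₃ y₁≤y₂ y₂≤y₃ =
  convex-P _ _ _ (quotient-mono b y₁≤y₂) (quotient-mono b y₂≤y₃)

Fibre : ∀ {a b} → Fin a → (Fin b → Set) → Fin (a * b) → Set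
Fibre {a} {b} c Q y = quotient {a} b y ≡ c × Q (remainder {a} b y)

convex-fibre : ∀ {a b} {Q : Fin b → Set} (c : Fin a) → Convex Q → Convex (Fibre c Q)
convex-fibre {a} {b} c convex-Q y₁ y₂ y₃ y₁≤y₂ y₂≤y₃ (y₁∈c , Q₁) (y₃∈c , Q₃) =
  y₂∈c , convex-Q _ _ _ (remainder-mono b y₁≤y₂ (trans y₁∈c (sym y₂∈c)))
                         (remainder-mono b y₂≤y₃ (trans y₂∈c (sym y₃∈c))) Q₁ Q₃
  where
  y₂∈c : quotient {a} b y₂ ≡ c
  y₂∈c = Finₚ.≤-antisym (subst (quotient {a} b y₂ ≤ᶠ_) y₃∈c (quotient-mono b y₂≤y₃))
                        (subst (_≤ᶠ quotient {a} b y₂) y₁∈c (quotient-mono b y₁≤y₂))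

entry : ∀ {X : Set} {L} → (Fin L → X) → ℕ → List X
entry {L = zero}  x t       = []
entry {L = suc L} x zero    = x zero ∷ []
entry {L = suc L} x (suc t) = entry (λ j → x (suc j)) t

entry-length : ∀ {X : Set} {L} (x : Fin L → X) t → length (entry x t) ≤ 1
entry-length {L = zero}  x t       = z≤n
entry-length {L = suc L} x zero    = ℕₚ.≤-refl
entry-length {L = suc L} x (suc t) = entry-length (λ j → x (suc j)) t

∈-entry : ∀ {X : Set} {L} (x : Fin L → X) j → x j ∈ entry x (toℕ j)
∈-entry x zero    = here refl
∈-entry x (suc j) = ∈-entry (λ j → x (suc j)) j

entry-∈ : ∀ {X : Set} {L} (x : Fin L → X) {t y} → y ∈ entry x t →
          Σ (Fin L) λ j → toℕ j ≡ t × y ≡ x j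
entry-∈ {L = suc L} x {zero} (here y≡x₀) = zero , refl , y≡x₀
entry-∈ {L = suc L} x {suc t} y∈ with entry-∈ (λ j → x (suc j)) y∈
... | j , j≡t , y≡xj = suc j , cong suc j≡t , y≡xj

Window : ℕ → ℕ → Set
Window t r = t ≤ r × r ≤ suc t

window : ∀ {X : Set} {L} → (Fin L → X) → ℕ → List X
window x t = entry x t ++ entry x (suc t)

window-length : ∀ {X : Set} {L} (x : Fin L → X) t → length (window x t) ≤ 2
window-length x t = subst (_≤ 2) (sym (length-++ (entry x t)))
  (ℕₚ.+-mono-≤ (entry-length x t) (entry-length x (suc t)))

∈-window : ∀ {X : Set} {L} (x : Fin L → X) {t} j → Window t (toℕ j) → x j ∈ window x t
∈-window x {t} j (t≤j , j≤1+t) with ℕₚ.m≤n⇒m<n∨m≡n j≤1+t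
... | inj₁ j<1+t = ∈-++⁺ˡ (subst (λ r → x j ∈ entry x r) j≡t (∈-entry x j))
  where
  j≡t : toℕ j ≡ t
  j≡t = ℕₚ.≤-antisym (ℕₚ.≤-pred j<1+t) t≤j
... | inj₂ j≡1+t = ∈-++⁺ʳ (entry x t) (subst (λ r → x j ∈ entry x r) j≡1+t (∈-entry x j))

window-∈ : ∀ {X : Set} {L} (x : Fin L → X) {t y} → y ∈ window x t →
           Σ (Fin L) λ j → y ≡ x j × Window t (toℕ j)
window-∈ x {t} y∈ with ∈-++⁻ (entry x t) y∈
... | inj₁ y∈t with entry-∈ x y∈t
...   | j , refl , y≡xj = j , y≡xj , ℕₚ.≤-refl , ℕₚ.n≤1+n _
window-∈ x {t} y∈ | inj₂ y∈1+t with entry-∈ x y∈1+t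
...   | j , j≡1+t , y≡xj = j , y≡xj , subst (t ≤_) (sym j≡1+t) (ℕₚ.n≤1+n t) , ℕₚ.≤-reflexive j≡1+t

window-convex : ∀ {M} r → Convex (λ (t : Fin M) → Window (toℕ t) r)
window-convex r i j l i≤j j≤l (i≤r , r≤1+i) (l≤r , r≤1+l) =
  ℕₚ.≤-trans j≤l l≤r , ℕₚ.≤-trans r≤1+i (s≤s i≤j)

-- The interior positions r such that r+1 is an end of the k-th edge of a
-- chain (positions k and k+1) are seen by step k-1 (by step 0 if k = 0).
window-pred : ∀ k r → suc r ≡ k ⊎ suc r ≡ suc k → Window (pred k) r
window-pred zero    r        (inj₁ ())
window-pred zero    .zero    (inj₂ refl) = z≤n , z≤n
window-pred (suc k) .k       (inj₁ refl) = ℕₚ.≤-refl , ℕₚ.n≤1+n k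
window-pred (suc k) .(suc k) (inj₂ refl) = ℕₚ.n≤1+n k , ℕₚ.≤-refl

-- A chain x₀ … x_L is laid out along the lists B 0, B 1, … when each of
-- its vertices lies in every B t whose window contains its interior index
-- (the vertex at position r+1 has interior index r; x₀ lies everywhere).
LaidOut : ∀ {X : Set} {L} → (Fin (suc L) → X) → (ℕ → List X) → Set
LaidOut {L = L} ch B =
  ∀ (j : Fin (suc L)) t → (∀ r → toℕ j ≡ suc r → Window t r) → ch j ∈ B t

chain-edge : ∀ {X : Set} {L} {ch : Fin (suc L) → X} {B : ℕ → List X} →
             LaidOut ch B → (k : Fin L) →
             ch (inject₁ k) ∈ B (pred (toℕ k)) × ch (suc k) ∈ B (pred (toℕ k))
chain-edge laid k =
  laid (inject₁ k) _ (λ r e → window-pred (toℕ k) r (inj₁ (trans (sym e) (Finₚ.toℕ-inject₁ k)))) ,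
  laid (suc k)     _ (λ r e → window-pred (toℕ k) r (inj₂ (sym e)))

onlyAt : ∀ {X : Set} {m} → Fin m → Fin m → List X → List X
onlyAt c i xs with c ≟ᶠ i
... | yes _ = xs
... | no _  = []

onlyAt-length : ∀ {X : Set} {m} (c i : Fin m) (xs : List X) → length (onlyAt c i xs) ≤ length xs
onlyAt-length c i xs with c ≟ᶠ i
... | yes _ = ℕₚ.≤-refl
... | no _  = z≤n

∈-onlyAt : ∀ {X : Set} {m} {c : Fin m} {x : X} {xs} → x ∈ xs → x ∈ onlyAt c c xs
∈-onlyAt {c = c} x∈ with c ≟ᶠ c
... | yes _ = x∈
... | no c≢c = ⊥-elim (c≢c refl)

onlyAt-∈ : ∀ {X : Set} {m} {c i : Fin m} {x : X} {xs} → x ∈ onlyAt c i xs → c ≡ i × x ∈ xs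
onlyAt-∈ {c = c} {i} x∈ with c ≟ᶠ i
... | yes c≡i = c≡i , x∈

upper : ∀ {n} → (Fin n → ℕ) → ℕ
upper f = max 0 (map f (allFin _))

≤-upper : ∀ {n} (f : Fin n → ℕ) i → f i ≤ upper f
≤-upper f i = All.lookup (xs≤max 0 (map f (allFin _))) (∈-map⁺ f (∈-allFin i))

bool-uip : {b c : Bool} (p p' : b ≡ c) → p ≡ p'
bool-uip = Decidable⇒UIP.≡-irrelevant Boolₚ._≟_

module Refinement (G : Graph)
  (F : Fin (Graph.n G) → Fin (Graph.n G) → Bool)
  (F⊆E : ∀ u v → F u v ≡ true → Graph.Adj G u v ≡ true)
  (s : Fin (Graph.n G) → Fin (Graph.n G) → ℕ)
  (U : Fin (Graph.n G) → Bool)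
  (q : Fin (Graph.n G) → ℕ)
  (k : ℕ)
  (P : PathwidthAtMost (Fin (Graph.n G)) (Edge G) k) where

  open Graph G using (n)
  open Construction G F s U q
  open PathDecomposition P
    renaming (m to m₀; bag to bag₀; width to width₀; cover to cover₀; edge to edge₀; contig to contig₀)

  edgeHost : ∀ u v → F u v ≡ true → Fin m₀
  edgeHost u v f = proj₁ (edge₀ u v (F⊆E u v f))

  pathHost : Fin n → Fin m₀
  pathHost u = proj₁ (cover₀ u)

  -- What a pair (u , v) of original vertices stands for: the subdivided
  -- edge uv (u < v), the path attached at u (u = v), or nothing.
  data Gadget : Fin n → Fin n → Set where
    subdivided : ∀ {u v} → toℕ u < toℕ v → F u v ≡ true → Gadget u v
    attached   : ∀ {u} → U u ≡ true → Gadget u u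
    absent     : ∀ {u v} → Gadget u v

  gadget : ∀ u v → Gadget u v
  gadget u v with u ≟ᶠ v
  gadget u .u | yes refl with U u Boolₚ.≟ true
  ... | yes h = attached h
  ... | no _  = absent
  gadget u v | no _ with toℕ u <? toℕ v | F u v Boolₚ.≟ true
  ... | yes lt | yes f = subdivided lt f
  ... | yes _  | no _  = absent
  ... | no _   | _     = absent

  -- The decision recovers every subdivided edge and attached path (with
  -- the same proofs, as these are unique).
  gadget-subdivided : ∀ {u v} lt f → gadget u v ≡ subdivided lt f
  gadget-subdivided {u} {v} lt f with u ≟ᶠ v
  ... | yes refl = ⊥-elim (ℕₚ.<-irrefl refl lt)
  ... | no _ with toℕ u <? toℕ v | F u v Boolₚ.≟ true
  ...   | yes lt' | yes f' = cong₂ subdivided (ℕₚ.<-irrelevant lt' lt) (bool-uip f' f)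
  ...   | yes _   | no ¬f  = ⊥-elim (¬f f)
  ...   | no ¬lt  | _      = ⊥-elim (¬lt lt)

  gadget-attached : ∀ {u} h → gadget u u ≡ attached h
  gadget-attached {u} h rewrite ≡-≟-identity _≟ᶠ_ (refl {x = u}) with U u Boolₚ.≟ true
  ... | yes h' = cong attached (bool-uip h' h)
  ... | no ¬h  = ⊥-elim (¬h h)

  gadgetSteps : ∀ {u v} → Fin m₀ → Gadget u v → ℕ → List V'
  gadgetSteps i (subdivided {u} {v} lt f) t = onlyAt (edgeHost u v f) i (window (sub u v lt f) t)
  gadgetSteps i (attached {u} h)          t = onlyAt (pathHost u) i (window (pth u h) t)
  gadgetSteps i absent                    t = []

  gadgetSteps-length : ∀ {u v} i (g : Gadget u v) t → length (gadgetSteps i g t) ≤ 2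
  gadgetSteps-length i (subdivided {u} {v} lt f) t =
    ℕₚ.≤-trans (onlyAt-length (edgeHost u v f) i _) (window-length (sub u v lt f) t)
  gadgetSteps-length i (attached {u} h) t =
    ℕₚ.≤-trans (onlyAt-length (pathHost u) i _) (window-length (pth u h) t)
  gadgetSteps-length i absent t = z≤n

  orig-∉-steps : ∀ {u v i t w} (g : Gadget u v) → ¬ (orig w ∈ gadgetSteps i g t)
  orig-∉-steps {i = i} (subdivided {u} {v} lt f) w∈
    with window-∈ (sub u v lt f) (proj₂ (onlyAt-∈ {c = edgeHost u v f} {i} w∈))
  ... | _ , ()
  orig-∉-steps {i = i} (attached {u} h) w∈
    with window-∈ (pth u h) (proj₂ (onlyAt-∈ {c = pathHost u} {i} w∈))
  ... | _ , ()
  orig-∉-steps absent ()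

  -- No gadget has more than maxStep interior vertices, so M steps suffice.
  maxStep : ℕ
  maxStep = upper (λ u → q u ⊔ upper (s u))

  s≤maxStep : ∀ u v → s u v ≤ maxStep
  s≤maxStep u v = ℕₚ.≤-trans (≤-upper (s u) v)
    (ℕₚ.≤-trans (ℕₚ.m≤n⊔m (q u) _) (≤-upper (λ u → q u ⊔ upper (s u)) u))

  q≤maxStep : ∀ u → q u ≤ maxStep
  q≤maxStep u = ℕₚ.≤-trans (ℕₚ.m≤m⊔n (q u) _) (≤-upper (λ u → q u ⊔ upper (s u)) u)

  M : ℕ
  M = suc maxStep

  bagAt : Fin m₀ → Fin n → Fin n → ℕ → List V'
  bagAt i u v t = gadgetSteps i (gadget u v) t ++ map orig (bag₀ i)

  bagAt-width : ∀ i u v t → length (bagAt i u v t) ≤ suc (k + 2)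
  bagAt-width i u v t = begin
    length (gadgetSteps i (gadget u v) t ++ map orig (bag₀ i))
      ≡⟨ length-++ (gadgetSteps i (gadget u v) t) ⟩
    length (gadgetSteps i (gadget u v) t) + length (map orig (bag₀ i))
      ≡⟨ cong (length (gadgetSteps i (gadget u v) t) +_) (length-map orig (bag₀ i)) ⟩
    length (gadgetSteps i (gadget u v) t) + length (bag₀ i)
      ≤⟨ ℕₚ.+-mono-≤ (gadgetSteps-length i (gadget u v) t) (width₀ i) ⟩
    2 + suc k
      ≡⟨ cong suc (ℕₚ.+-comm 2 k) ⟩
    suc (k + 2) ∎
    where open ℕₚ.≤-Reasoning

  orig-∈-bagAt : ∀ {i w} u v t → w ∈ bag₀ i → orig w ∈ bagAt i u v t
  orig-∈-bagAt {i} u v t w∈ = ∈-++⁺ʳ (gadgetSteps i (gadget u v) t) (∈-map⁺ orig w∈)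

  bagAt-orig : ∀ {i w} u v t → orig w ∈ bagAt i u v t → w ∈ bag₀ i
  bagAt-orig {i} u v t w∈ with ∈-++⁻ (gadgetSteps i (gadget u v) t) w∈
  ... | inj₁ w∈steps = ⊥-elim (orig-∉-steps (gadget u v) w∈steps)
  ... | inj₂ w∈orig with ∈-map⁻ orig w∈orig
  ...   | _ , w∈₀ , refl = w∈₀

  bagAt-cong : ∀ {i i' u u' v v' t} → i ≡ i' → u ≡ u' → v ≡ v' → bagAt i u v t ≡ bagAt i' u' v' t
  bagAt-cong refl refl refl = refl

  -- The bags of G' are indexed by (i , u , v , t) in lexicographic order.
  Index : Set
  Index = Fin (m₀ * (n * (n * M)))

  decode : Index → Fin m₀ × Fin n × Fin n × Fin M
  decode y = map₂ (λ z → map₂ (remQuot {n} M) (remQuot {n} _ z)) (remQuot {m₀} _ y)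

  index : Fin m₀ → Fin n → Fin n → Fin M → Index
  index i u v t = combine i (combine u (combine v t))

  decode-index : ∀ i u v t → decode (index i u v t) ≡ (i , u , v , t)
  decode-index i u v t = begin
    decode (combine i (combine u (combine v t)))
      ≡⟨ cong (map₂ (λ z → map₂ (remQuot {n} M) (remQuot {n} _ z))) (Finₚ.remQuot-combine i _) ⟩
    (i , map₂ (remQuot {n} M) (remQuot {n} _ (combine u (combine v t))))
      ≡⟨ cong (λ p → i , map₂ (remQuot {n} M) p) (Finₚ.remQuot-combine u _) ⟩
    (i , u , remQuot {n} M (combine v t))
      ≡⟨ cong (λ p → i , u , p) (Finₚ.remQuot-combine v t) ⟩
    (i , u , v , t) ∎
    where open ≡-Reasoning

  module Position (c : Fin m₀ × Fin n × Fin n × Fin M) where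
    i : Fin m₀
    i = proj₁ c
    u v : Fin n
    u = proj₁ (proj₂ c)
    v = proj₁ (proj₂ (proj₂ c))
    t : Fin M
    t = proj₂ (proj₂ (proj₂ c))

  bagOf : Fin m₀ × Fin n × Fin n × Fin M → List V'
  bagOf (i , u , v , t) = bagAt i u v (toℕ t)

  bag : Index → List V'
  bag y = bagOf (decode y)

  realise : ∀ i u v {t} → t ≤ maxStep → Σ Index λ y → bag y ≡ bagAt i u v t
  realise i u v {t} t≤max = index i u v (fromℕ< (s≤s t≤max)) ,
    trans (cong bagOf (decode-index i u v _)) (cong (bagAt i u v) (Finₚ.toℕ-fromℕ< (s≤s t≤max)))

  inSomeBag : ∀ i u v {t x} → t ≤ maxStep → x ∈ bagAt i u v t → ∃ λ y → x ∈ bag y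
  inSomeBag i u v t≤max x∈ with realise i u v t≤max
  ... | y , bag≡ = y , subst (_ ∈_) (sym bag≡) x∈

  inCommonBag : ∀ i u v {t x x'} → t ≤ maxStep → x ∈ bagAt i u v t → x' ∈ bagAt i u v t →
                ∃ λ y → x ∈ bag y × x' ∈ bag y
  inCommonBag i u v t≤max x∈ x'∈ with realise i u v t≤max
  ... | y , bag≡ = y , subst (_ ∈_) (sym bag≡) x∈ , subst (_ ∈_) (sym bag≡) x'∈

  record Placement (x : V') : Set where
    field
      host        : Fin m₀
      left right  : Fin n
      pos         : ℕ
      pos≤maxStep : pos ≤ maxStep
      new         : ∀ {w} → ¬ (x ≡ orig w)
      occurs      : ∀ {i u v t} → x ∈ gadgetSteps i (gadget u v) t →
                    i ≡ host × u ≡ left × v ≡ right × Window t pos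
      appears     : ∀ {t} → Window t pos → x ∈ gadgetSteps host (gadget left right) t

  sub-occurs : ∀ {u v lt f r i u' v' t} (g : Gadget u' v') → sub u v lt f r ∈ gadgetSteps i g t →
               i ≡ edgeHost u v f × u' ≡ u × v' ≡ v × Window t (toℕ r)
  sub-occurs {i = i} (subdivided {u'} {v'} lt' f') x∈ with onlyAt-∈ {c = edgeHost u' v' f'} {i} x∈
  ... | host≡i , x∈window with window-∈ (sub u' v' lt' f') x∈window
  ...   | _ , refl , inWindow = sym host≡i , refl , refl , inWindow
  sub-occurs {i = i} (attached {u'} h) x∈ with window-∈ (pth u' h) (proj₂ (onlyAt-∈ {c = pathHost u'} {i} x∈))
  ... | _ , ()
  sub-occurs absent ()

  pth-occurs : ∀ {u h r i u' v' t} (g : Gadget u' v') → pth u h r ∈ gadgetSteps i g t →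
               i ≡ pathHost u × u' ≡ u × v' ≡ u × Window t (toℕ r)
  pth-occurs {i = i} (subdivided {u'} {v'} lt f) x∈
    with window-∈ (sub u' v' lt f) (proj₂ (onlyAt-∈ {c = edgeHost u' v' f} {i} x∈))
  ... | _ , ()
  pth-occurs {i = i} (attached {u'} h') x∈ with onlyAt-∈ {c = pathHost u'} {i} x∈
  ... | host≡i , x∈window with window-∈ (pth u' h') x∈window
  ...   | _ , refl , inWindow = sym host≡i , refl , refl , inWindow
  pth-occurs absent ()

  subPlacement : ∀ u v lt f r → Placement (sub u v lt f r)
  subPlacement u v lt f r = record
    { host        = edgeHost u v f
    ; left        = u
    ; right       = v
    ; pos         = toℕ r
    ; pos≤maxStep = ℕₚ.≤-trans (ℕₚ.<⇒≤ (Finₚ.toℕ<n r)) (s≤maxStep u v)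
    ; new         = λ ()
    ; occurs      = sub-occurs (gadget _ _)
    ; appears     = λ inWindow →
        subst (λ g → sub u v lt f r ∈ gadgetSteps (edgeHost u v f) g _) (sym (gadget-subdivided lt f))
              (∈-onlyAt (∈-window (sub u v lt f) r inWindow))
    }

  pthPlacement : ∀ u h r → Placement (pth u h r)
  pthPlacement u h r = record
    { host        = pathHost u
    ; left        = u
    ; right       = u
    ; pos         = toℕ r
    ; pos≤maxStep = ℕₚ.≤-trans (ℕₚ.<⇒≤ (Finₚ.toℕ<n r)) (q≤maxStep u)
    ; new         = λ ()
    ; occurs      = pth-occurs (gadget _ _)
    ; appears     = λ inWindow →
        subst (λ g → pth u h r ∈ gadgetSteps (pathHost u) g _) (sym (gadget-attached h))
              (∈-onlyAt (∈-window (pth u h) r inWindow))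
    }

  module Placed {x : V'} (p : Placement x) where
    open Placement p

    Occurrence : Index → Set
    Occurrence = Fibre host (Fibre left (Fibre right (λ (t : Fin M) → Window (toℕ t) pos)))

    occurrence : ∀ y → Occurrence y ⇔ x ∈ bag y
    occurrence y = mk⇔ into out
      where
      into : Occurrence y → x ∈ bag y
      into (i≡ , u≡ , v≡ , inWindow) =
        subst (x ∈_) (sym (bagAt-cong i≡ u≡ v≡)) (∈-++⁺ˡ (appears inWindow))
      out : x ∈ bag y → Occurrence y
      out x∈ with ∈-++⁻ (gadgetSteps i (gadget u v) (toℕ t)) x∈
        where open Position (decode y)
      ... | inj₁ x∈steps = occurs x∈steps
      ... | inj₂ x∈orig with ∈-map⁻ orig x∈orig
      ...   | _ , _ , x≡orig = ⊥-elim (new x≡orig)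

    convex : Convex (λ y → x ∈ bag y)
    convex = convex-⇔ occurrence
      (convex-fibre host (convex-fibre left (convex-fibre right (window-convex pos))))

    covered : ∃ λ y → x ∈ bag y
    covered = inSomeBag host left right pos≤maxStep
      (∈-++⁺ˡ (appears (ℕₚ.≤-refl , ℕₚ.n≤1+n pos)))

  -- An original vertex occurs in the copies of the bags of P containing it.
  orig-convex : ∀ w → Convex (λ y → orig w ∈ bag y)
  orig-convex w = convex-⇔ orig-∈-bag (convex-quotient _ (contig₀ w))
    where
    orig-∈-bag : ∀ y → w ∈ bag₀ (quotient {m₀} _ y) ⇔ orig w ∈ bag y
    orig-∈-bag y = mk⇔ (orig-∈-bagAt u v (toℕ t)) (bagAt-orig u v (toℕ t))
      where open Position (decode y)

  snoc-cases : ∀ L g last (j : Fin (suc L)) →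
               snoc L g last j ≡ last ⊎ Σ (Fin L) λ r → toℕ j ≡ toℕ r × snoc L g last j ≡ g r
  snoc-cases zero    g last zero    = inj₁ refl
  snoc-cases (suc L) g last zero    = inj₂ (zero , refl , refl)
  snoc-cases (suc L) g last (suc j) with snoc-cases L (λ r → g (suc r)) last j
  ... | inj₁ isLast              = inj₁ isLast
  ... | inj₂ (r , j≡r , isTerm) = inj₂ (suc r , cong suc j≡r , isTerm)

  subChain-laidOut : ∀ u v lt f → LaidOut (subChain u v lt f) (bagAt (edgeHost u v f) u v)
  subChain-laidOut u v lt f zero t _ = orig-∈-bagAt u v t (proj₁ (proj₂ (edge₀ u v (F⊆E u v f))))
  subChain-laidOut u v lt f (suc j) t inWindow with snoc-cases (s u v) (sub u v lt f) (orig v) j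
  ... | inj₁ isLast = subst (_∈ _) (sym isLast) (orig-∈-bagAt u v t (proj₂ (proj₂ (edge₀ u v (F⊆E u v f)))))
  ... | inj₂ (r , j≡r , isTerm) = subst (_∈ _) (sym isTerm)
    (∈-++⁺ˡ (Placement.appears (subPlacement u v lt f r) (inWindow (toℕ r) (cong suc j≡r))))

  pathChain-laidOut : ∀ u h → LaidOut (pathChain u h) (bagAt (pathHost u) u u)
  pathChain-laidOut u h zero    t _        = orig-∈-bagAt u u t (proj₂ (cover₀ u))
  pathChain-laidOut u h (suc r) t inWindow =
    ∈-++⁺ˡ (Placement.appears (pthPlacement u h r) (inWindow (toℕ r) refl))

  edges : ∀ x y → D x y → ∃ λ z → x ∈ bag z × y ∈ bag z
  edges _ _ (keep u v uv∈E _) with edge₀ u v uv∈E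
  ... | i , u∈ , v∈ = inCommonBag i u v z≤n (orig-∈-bagAt u v 0 u∈) (orig-∈-bagAt u v 0 v∈)
  edges _ _ (subE u v lt f j) with chain-edge (subChain-laidOut u v lt f) j
  ... | x∈ , y∈ = inCommonBag (edgeHost u v f) u v
    (ℕₚ.≤-trans ℕₚ.pred[n]≤n (ℕₚ.≤-trans (Finₚ.toℕ≤pred[n] j) (s≤maxStep u v))) x∈ y∈
  edges _ _ (pthE u h j) with chain-edge (pathChain-laidOut u h) j
  ... | x∈ , y∈ = inCommonBag (pathHost u) u u
    (ℕₚ.≤-trans ℕₚ.pred[n]≤n (ℕₚ.≤-trans (ℕₚ.<⇒≤ (Finₚ.toℕ<n j)) (q≤maxStep u))) x∈ y∈

  cover : ∀ x → ∃ λ y → x ∈ bag y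
  cover (orig w) with cover₀ w
  ... | i , w∈ = inSomeBag i w w z≤n (orig-∈-bagAt w w 0 w∈)
  cover (sub u v lt f r) = Placed.covered (subPlacement u v lt f r)
  cover (pth u h r)      = Placed.covered (pthPlacement u h r)

  contig : ∀ x → Convex (λ y → x ∈ bag y)
  contig (orig w)         = orig-convex w
  contig (sub u v lt f r) = Placed.convex (subPlacement u v lt f r)
  contig (pth u h r)      = Placed.convex (pthPlacement u h r)

  decomposition : PathwidthAtMost V' E' (k + 2)
  decomposition = record
    { m      = m₀ * (n * (n * M))
    ; bag    = bag
    ; width  = λ y → let open Position (decode y) in bagAt-width i u v (toℕ t)
    ; cover  = cover
    ; edge   = λ where
        x y (inj₁ xy) → edges x y xy
        x y (inj₂ yx) → let (z , y∈ , x∈) = edges y x yx in z , x∈ , y∈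
    ; contig = contig
    }

corollary1 : (G : Graph)
    → (F : Fin (Graph.n G) → Fin (Graph.n G) → Bool)
    → (∀ u v → F u v ≡ F v u)
    → (∀ u v → F u v ≡ true → Graph.Adj G u v ≡ true)
    → (s : Fin (Graph.n G) → Fin (Graph.n G) → ℕ)
    → (U : Fin (Graph.n G) → Bool)
    → (q : Fin (Graph.n G) → ℕ)
    → (k : ℕ)
    → PathwidthAtMost (Fin (Graph.n G)) (Edge G) k
    → PathwidthAtMost (Construction.V' G F s U q) (Construction.E' G F s U q) (k + 2)
corollary1 G F _ F⊆E s U q k P = Refinement.decomposition G F F⊆E s U q k P
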